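{- Let $n\ge 3$ and $T_{4,n}=C_4\Box C_n$. Then $\chi(T_{4,n}^2)=6$ if $n\equiv 0\pmod 3$; $\chi(T_{4,4}^2)=8$; and $\chi(T_{4,n}^2)=7$ otherwise (i.e. if $n\not\equiv 0\pmod 3$ and $n\ne 4$).
   Context: $C_j$ denotes the cycle on $j$ vertices; $\Box$ is the Cartesian product of graphs. The square $G^2$ of a graph $G$ has vertex set $V(G)$, two distinct vertices being adjacent iff their distance in $G$ is at most 2. $\chi$ is the chromatic number. -}

module Defs where

open import Level using (0ℓ)
open import Data.Nat using (ℕ; suc; _+_; _%_; _<_; NonZero)
open import Data.Fin using (Fin; toℕ)
open import Data.Product using (_×_; Σ; ∃; _,_)
open import Data.Sum using (_⊎_)
open import Relation.Binary.PropositionalEquality using (_≡_; _≢_)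
open import Relation.Nullary using (¬_)

record Graph : Set₁ where
  field
    V   : Set
    Adj : V → V → Set
open Graph public

-- Cycle C_n on vertex set Fin n (meaningful for n ≥ 3):
-- i ~ j iff j ≡ i + 1 (mod n) or i ≡ j + 1 (mod n).
Cycle : (n : ℕ) → .{{_ : NonZero n}} → Graph
Cycle n = record
  { V   = Fin n
  ; Adj = λ i j → ((toℕ i + 1) % n ≡ toℕ j) ⊎ ((toℕ j + 1) % n ≡ toℕ i)
  }

_□_ : Graph → Graph → Graph
G □ H = record
  { V   = V G × V H
  ; Adj = λ { (g , h) (g' , h') → (Adj G g g' × h ≡ h') ⊎ (g ≡ g' × Adj H h h') }
  }

square : Graph → Graph
square G = record
  { V   = V G
  ; Adj = λ u v → u ≢ v × (Adj G u v ⊎ Σ (V G) (λ w → Adj G u w × Adj G w v))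
  }

ProperColouring : Graph → ℕ → Set
ProperColouring G k =
  Σ (V G → Fin k) (λ c → ∀ u v → Adj G u v → c u ≢ c v)

ChromaticNumber : Graph → ℕ → Set
ChromaticNumber G k =
  ProperColouring G k × (∀ m → m < k → ¬ ProperColouring G m)

T4 : (n : ℕ) → .{{_ : NonZero n}} → Graph
T4 n = Cycle 4 □ Cycle n

module Submission where

-- Vertices of T₄,ₙ = C₄ □ Cₙ are pairs (row, column).  In the square a vertex sees its
-- whole column (C₄ has diameter two), the close rows of the neighbouring columns, and its
-- own row two columns away; `Ahead` names these configurations, and
-- `square-adjacent⇒ahead` / `ahead⇒square-adjacent` show they are exactly the edges.
--
-- A colour occurs at most once per column and in at most two of any three
-- consecutive columns (its rows in adjacent columns must be opposite).  Summing over the n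
-- cyclic windows, each class has at most 2n/3 of the 4n vertices (`ClassSizes`), whence
-- k ≥ 6, k ≥ 7 if 3 ∤ n (no class reaches 2n/3), and k ≥ 8 if n = 4 (classes have ≤ 2).
--
-- A word of n columns colours T₄,ₙ², properly as soon as all its cyclic
-- windows of three columns are compatible, a decidable condition.  A repeated block of
-- three columns plus a tail of length 0, 4 or 5 covers each residue of n mod 3; n = 4 and
-- n = 5 get words of their own.

open import Defs
open import Data.Empty using (⊥; ⊥-elim)
open import Data.Fin using (Fin; zero; suc; toℕ; fromℕ<; fromℕ; inject₁; punchIn)
open import Data.Fin.Patterns using (0F; 1F; 2F; 3F; 4F; 5F; 6F; 7F)
open import Data.Fin.Properties using (_≟_; all?; any?; punchInᵢ≢i; suc-injective; toℕ-fromℕ<; toℕ-injective; toℕ<n; toℕ-inject₁; toℕ-fromℕ)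
open import Data.List using (List; []; _∷_; _++_; take; length)
open import Data.List.Properties using (length-++; length-take)
open import Data.Nat using (ℕ; zero; suc; _+_; _*_; _≤_; _<_; _%_; _/_; _⊓_; _≤?_; _<?_; NonZero; >-nonZero; >-nonZero⁻¹; z≤n; s≤s)
open import Data.Nat.Coprimality using (coprime?; coprime-divisor)
open import Data.Nat.DivMod using (m%n<n; m<n⇒m%n≡m; n%n≡0; m≡m%n+[m/n]*n; %-distribˡ-+; m%n%n≡m%n; [m+n]%n≡m%n; m≥n⇒m/n>0)
open import Data.Nat.Divisibility using (_∣_; divides; ∣m+n∣m⇒∣n; ∣⇒≤; n∣m⇒m%n≡0)
open import Data.Nat.Properties hiding (_≟_; suc-injective)
import Data.Nat.Properties as Nat
open import Algebra.Properties.CommutativeSemigroup +-commutativeSemigroup using (xy∙z≈xz∙y; xy∙z≈y∙xz)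
open import Algebra.Properties.Semiring.Sum +-*-semiring
  using (sum; sum-syntax; ∑-distrib-+; ∑-comm; sum-cong-≗; sum-init-last; sum-remove; sum-replicate-zero; *-distribˡ-sum)
open import Data.Product using (_×_; _,_; ∃; proj₁; proj₂)
open import Data.Sum using (_⊎_; inj₁; inj₂; swap)
open import Data.Unit using (⊤; tt)
open import Function using (_∘_)
open import Relation.Binary.PropositionalEquality
open import Relation.Nullary using (yes; no; ¬_; Dec; ¬?; _×-dec_; _⊎-dec_; _→-dec_)
open import Relation.Nullary.Decidable using (from-yes)

∑-const : ∀ m x → ∑[ i < m ] x ≡ m * x
∑-const zero    x = refl
∑-const (suc m) x = cong (x +_) (∑-const m x)

∑-bounded : ∀ {m} {f : Fin m → ℕ} b → (∀ i → f i ≤ b) → sum f ≤ m * b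
∑-bounded {zero}  b f≤b = z≤n
∑-bounded {suc m} b f≤b = +-mono-≤ (f≤b zero) (∑-bounded b (f≤b ∘ suc))

∑-rotate : ∀ n (g : ℕ → ℕ) → g n ≡ g 0 → ∑[ i < n ] g (toℕ i + 1) ≡ ∑[ i < n ] g (toℕ i)
∑-rotate n g gn≡g0 = +-cancelʳ-≡ (g 0) _ _ (begin
  ∑[ i < n ] g (toℕ i + 1) + g 0                      ≡⟨ +-comm _ (g 0) ⟩
  g 0 + ∑[ i < n ] g (toℕ i + 1)                      ≡⟨ cong (g 0 +_) (sum-cong-≗ {n} (λ i → cong g (+-comm (toℕ i) 1))) ⟩
  ∑[ i < suc n ] g (toℕ i)                            ≡⟨ sum-init-last (g ∘ toℕ) ⟩
  ∑[ i < n ] g (toℕ (inject₁ i)) + g (toℕ (fromℕ n))  ≡⟨ cong₂ _+_ (sum-cong-≗ {n} (cong g ∘ toℕ-inject₁)) (cong g (toℕ-fromℕ n)) ⟩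
  ∑[ i < n ] g (toℕ i) + g n                          ≡⟨ cong (∑[ i < n ] g (toℕ i) +_) gn≡g0 ⟩
  ∑[ i < n ] g (toℕ i) + g 0                          ∎)
  where open ≡-Reasoning

δ : ∀ {k} → Fin k → Fin k → ℕ
δ x a with x ≟ a
... | yes _ = 1
... | no  _ = 0

δ-≢ : ∀ {k} {x a : Fin k} → x ≢ a → δ x a ≡ 0
δ-≢ {x = x} {a} x≢a with x ≟ a
... | yes x≡a = ⊥-elim (x≢a x≡a)
... | no  _   = refl

δ-refl : ∀ {k} (x : Fin k) → δ x x ≡ 1
δ-refl x with x ≟ x
... | yes _   = refl
... | no  x≢x = ⊥-elim (x≢x refl)

∑-δ : ∀ {k} (x : Fin k) → ∑[ a < k ] δ x a ≡ 1
∑-δ {suc k} x = begin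
  sum (δ x)                             ≡⟨ sum-remove (δ x) ⟩
  δ x x + ∑[ j < k ] δ x (punchIn x j)  ≡⟨ cong₂ _+_ (δ-refl x) (sum-cong-≗ {k} (λ j → δ-≢ (punchInᵢ≢i x j ∘ sym))) ⟩
  1 + ∑[ j < k ] 0                      ≡⟨ cong (1 +_) (sum-replicate-zero k) ⟩
  1                                     ∎
  where open ≡-Reasoning

count : ∀ {m k} → (Fin m → Fin k) → Fin k → ℕ
count {m} f a = ∑[ r < m ] δ (f r) a

count-absent : ∀ {m k} (f : Fin m → Fin k) a → (∀ r → f r ≢ a) → count f a ≡ 0
count-absent {m} f a f≢a = trans (sum-cong-≗ (δ-≢ ∘ f≢a)) (sum-replicate-zero m)

count-present : ∀ {m k} (f : Fin m → Fin k) a → 0 < count f a → ∃ λ r → f r ≡ a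
count-present {suc m} f a pos with f zero ≟ a
... | yes f0≡a = zero , f0≡a
... | no  _    with count-present (f ∘ suc) a pos
...   | r , fr≡a = suc r , fr≡a

count-injective : ∀ {m k} (f : Fin m → Fin k) → (∀ r s → r ≢ s → f r ≢ f s) → ∀ a → count f a ≤ 1
count-injective {zero}  f inj a = z≤n
count-injective {suc m} f inj a with f zero ≟ a
... | yes refl = s≤s (≤-reflexive (count-absent (f ∘ suc) a (λ r → inj (suc r) zero (λ ()))))
... | no  _    = count-injective (f ∘ suc) (λ r s r≢s → inj (suc r) (suc s) (r≢s ∘ suc-injective)) a

module _ {n : ℕ} .{{_ : NonZero n}} where

  cyc : ℕ → Fin n
  cyc m = fromℕ< (m%n<n m n)

  toℕ-cyc : ∀ m → toℕ (cyc m) ≡ m % n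
  toℕ-cyc m = toℕ-fromℕ< (m%n<n m n)

  cyc-toℕ : ∀ j → cyc (toℕ j) ≡ j
  cyc-toℕ j = toℕ-injective (trans (toℕ-cyc (toℕ j)) (m<n⇒m%n≡m (toℕ<n j)))

  cyc-period : cyc n ≡ cyc 0
  cyc-period = toℕ-injective (begin
    toℕ (cyc n) ≡⟨ toℕ-cyc n ⟩
    n % n       ≡⟨ n%n≡0 n ⟩
    0           ≡⟨ m<n⇒m%n≡m (>-nonZero⁻¹ n) ⟨
    0 % n       ≡⟨ toℕ-cyc 0 ⟨
    toℕ (cyc 0) ∎)
    where open ≡-Reasoning

  -- The forward edges of Cₙ: Adj (Cycle n) j j' unfolds to Step j j' ⊎ Step j' j.
  Step : Fin n → Fin n → Set
  Step j j' = (toℕ j + 1) % n ≡ toℕ j'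

  next : Fin n → Fin n
  next j = cyc (toℕ j + 1)

  step-next : ∀ j → Step j (next j)
  step-next j = sym (toℕ-cyc (toℕ j + 1))

  step⇒next : ∀ {j j'} → Step j j' → j' ≡ next j
  step⇒next {j} s = toℕ-injective (trans (sym s) (step-next j))

  shift⇒∣ : ∀ m d → (m + d) % n ≡ m % n → n ∣ d
  shift⇒∣ m d eq = ∣m+n∣m⇒∣n (divides ((m + d) / n) quotients) (divides (m / n) refl)
    where
    open ≡-Reasoning
    quotients : m / n * n + d ≡ (m + d) / n * n
    quotients = +-cancelˡ-≡ (m % n) _ _ (begin
      m % n + (m / n * n + d)        ≡⟨ +-assoc (m % n) _ d ⟨
      m % n + m / n * n + d          ≡⟨ cong (_+ d) (m≡m%n+[m/n]*n m n) ⟨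
      m + d                          ≡⟨ m≡m%n+[m/n]*n (m + d) n ⟩
      (m + d) % n + (m + d) / n * n  ≡⟨ cong (_+ (m + d) / n * n) eq ⟩
      m % n + (m + d) / n * n        ∎)

  ∣-below : ∀ {e} → n ∣ e → e < n → e ≡ 0
  ∣-below {zero}  _   _   = refl
  ∣-below {suc e} n∣e e<n = ⊥-elim (<⇒≱ e<n (∣⇒≤ n∣e))

  shift-distinct : ∀ m d → 0 < d → d < n → (m + d) % n ≢ m % n
  shift-distinct m d 0<d d<n eq with () ← subst (0 <_) (∣-below (shift⇒∣ m d eq) d<n) 0<d

  residue-cancel-≤ : ∀ {a b} d → a ≤ b → b < n → (a + d) % n ≡ (b + d) % n → a ≡ b
  residue-cancel-≤ {a} d a≤b b<n eq with e , refl ← m≤n⇒∃[o]m+o≡n a≤b =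
    sym (trans (cong (a +_) e≡0) (+-identityʳ a))
    where
    e≡0 : e ≡ 0
    e≡0 = ∣-below (shift⇒∣ (a + d) e (sym (trans eq (cong (_% n) (xy∙z≈xz∙y a e d)))))
                  (≤-trans (s≤s (m≤n+m e a)) b<n)

  residue-cancel : ∀ {a b} d → a < n → b < n → (a + d) % n ≡ (b + d) % n → a ≡ b
  residue-cancel {a} {b} d a<n b<n eq with ≤-total a b
  ... | inj₁ a≤b = residue-cancel-≤ d a≤b b<n eq
  ... | inj₂ b≤a = sym (residue-cancel-≤ d b≤a a<n (sym eq))

  step-injective : ∀ {j j' w} → Step j w → Step j' w → j ≡ j'
  step-injective {j} {j'} s s' = toℕ-injective (residue-cancel 1 (toℕ<n j) (toℕ<n j') (trans s (sym s')))

  step-functional : ∀ {j w w'} → Step j w → Step j w' → w ≡ w'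
  step-functional s s' = toℕ-injective (trans (sym s) s')

  %-suc : ∀ x → (x % n + 1) % n ≡ (x + 1) % n
  %-suc x = begin
    (x % n + 1) % n          ≡⟨ %-distribˡ-+ (x % n) 1 n ⟩
    (x % n % n + 1 % n) % n  ≡⟨ cong (λ y → (y + 1 % n) % n) (m%n%n≡m%n x n) ⟩
    (x % n + 1 % n) % n      ≡⟨ %-distribˡ-+ x 1 n ⟨
    (x + 1) % n              ∎
    where open ≡-Reasoning

  step-step : ∀ {j j' j''} → Step j j' → Step j' j'' → (toℕ j + 2) % n ≡ toℕ j''
  step-step {j} {j'} {j''} s s' = begin
    (toℕ j + 2) % n            ≡⟨ cong (_% n) (+-assoc (toℕ j) 1 1) ⟨
    (toℕ j + 1 + 1) % n        ≡⟨ %-suc (toℕ j + 1) ⟨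
    ((toℕ j + 1) % n + 1) % n  ≡⟨ cong (λ x → (x + 1) % n) s ⟩
    (toℕ j' + 1) % n           ≡⟨ s' ⟩
    toℕ j''                    ∎
    where open ≡-Reasoning

  step-moves : 2 ≤ n → ∀ {j j'} → Step j j' → j ≢ j'
  step-moves 2≤n {j} s refl =
    shift-distinct (toℕ j) 1 (s≤s z≤n) 2≤n (trans s (sym (m<n⇒m%n≡m (toℕ<n j))))

  two-steps-move : 3 ≤ n → ∀ {j j' j''} → Step j j' → Step j' j'' → j ≢ j''
  two-steps-move 3≤n {j} s s' refl =
    shift-distinct (toℕ j) 2 (s≤s z≤n) 3≤n (trans (step-step s s') (sym (m<n⇒m%n≡m (toℕ<n j))))

  ∑-next : ∀ (f : Fin n → ℕ) → ∑[ j < n ] f (next j) ≡ ∑[ j < n ] f j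
  ∑-next f = trans (∑-rotate n (f ∘ cyc) (cong f cyc-period)) (sum-cong-≗ {n} (cong f ∘ cyc-toℕ))

Close : Fin 4 → Fin 4 → Set
Close i i' = i ≡ i' ⊎ Adj (Cycle 4) i i'

adjacent₄? : ∀ i i' → Dec (Adj (Cycle 4) i i')
adjacent₄? i i' = ((toℕ i + 1) % 4 Nat.≟ toℕ i') ⊎-dec ((toℕ i' + 1) % 4 Nat.≟ toℕ i)

close? : ∀ i i' → Dec (Close i i')
close? i i' = (i ≟ i') ⊎-dec adjacent₄? i i'

rows-within-two : ∀ i i' → i ≢ i' → Adj (Cycle 4) i i' ⊎ ∃ λ t → Adj (Cycle 4) i t × Adj (Cycle 4) t i'
rows-within-two = from-yes (all? λ i → all? λ i' → ¬? (i ≟ i') →-dec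
  (adjacent₄? i i' ⊎-dec any? λ t → adjacent₄? i t ×-dec adjacent₄? t i'))

-- Only the opposite row is far from a given row, so going far twice returns to the start.
far-twice : ∀ r s t → ¬ Close r s → ¬ Close s t → r ≡ t
far-twice = from-yes (all? λ r → all? λ s → all? λ t → ¬? (close? r s) →-dec ¬? (close? s t) →-dec (r ≟ t))

module _ {n : ℕ} .{{_ : NonZero n}} where

  -- The vertices at distance at most two from (i , j) lying in its own column or further on.
  data Ahead : V (T4 n) → V (T4 n) → Set where
    same-column : ∀ {i i' j} → i ≢ i' → Ahead (i , j) (i' , j)
    next-column : ∀ {i i' j j'} → Close i i' → Step j j' → Ahead (i , j) (i' , j')
    two-ahead   : ∀ {i j j' j''} → Step j j' → Step j' j'' → Ahead (i , j) (i , j'')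

  square-adjacent⇒ahead : ∀ u v → Adj (square (T4 n)) u v → Ahead u v ⊎ Ahead v u
  square-adjacent⇒ahead (i , j) (i' , .j) (u≢v , inj₁ (inj₁ (_ , refl))) =
    inj₁ (same-column λ i≡i' → u≢v (cong (_, j) i≡i'))
  square-adjacent⇒ahead _ _ (_ , inj₁ (inj₂ (refl , inj₁ s))) = inj₁ (next-column (inj₁ refl) s)
  square-adjacent⇒ahead _ _ (_ , inj₁ (inj₂ (refl , inj₂ s))) = inj₂ (next-column (inj₁ refl) s)
  square-adjacent⇒ahead (i , j) (i' , .j) (u≢v , inj₂ (_ , inj₁ (_ , refl) , inj₁ (_ , refl))) =
    inj₁ (same-column λ i≡i' → u≢v (cong (_, j) i≡i'))
  square-adjacent⇒ahead _ _ (_ , inj₂ (_ , inj₁ (a , refl) , inj₂ (refl , inj₁ s))) = inj₁ (next-column (inj₂ a) s)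
  square-adjacent⇒ahead _ _ (_ , inj₂ (_ , inj₁ (a , refl) , inj₂ (refl , inj₂ s))) = inj₂ (next-column (inj₂ (swap a)) s)
  square-adjacent⇒ahead _ _ (_ , inj₂ (_ , inj₂ (refl , inj₁ s) , inj₁ (b , refl))) = inj₁ (next-column (inj₂ b) s)
  square-adjacent⇒ahead _ _ (_ , inj₂ (_ , inj₂ (refl , inj₂ s) , inj₁ (b , refl))) = inj₂ (next-column (inj₂ (swap b)) s)
  square-adjacent⇒ahead _ _ (_ , inj₂ (_ , inj₂ (refl , inj₁ s) , inj₂ (refl , inj₁ s'))) = inj₁ (two-ahead s s')
  square-adjacent⇒ahead _ _ (_ , inj₂ (_ , inj₂ (refl , inj₂ s) , inj₂ (refl , inj₂ s'))) = inj₂ (two-ahead s' s)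
  square-adjacent⇒ahead (i , j) _ (u≢v , inj₂ (_ , inj₂ (refl , inj₁ s) , inj₂ (refl , inj₂ s'))) =
    ⊥-elim (u≢v (cong (i ,_) (step-injective s s')))
  square-adjacent⇒ahead (i , j) _ (u≢v , inj₂ (_ , inj₂ (refl , inj₂ s) , inj₂ (refl , inj₁ s'))) =
    ⊥-elim (u≢v (cong (i ,_) (step-functional s s')))

  ahead⇒square-adjacent : 3 ≤ n → ∀ {u v} → Ahead u v → Adj (square (T4 n)) u v
  ahead⇒square-adjacent _ {i , j} (same-column {i' = i'} i≢i') with rows-within-two i i' i≢i'
  ... | inj₁ a           = (i≢i' ∘ cong proj₁) , inj₁ (inj₁ (a , refl))
  ... | inj₂ (t , a , b) = (i≢i' ∘ cong proj₁) , inj₂ ((t , j) , inj₁ (a , refl) , inj₁ (b , refl))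
  ahead⇒square-adjacent 3≤n (next-column (inj₁ refl) s) =
    (step-moves (≤-trans (n≤1+n 2) 3≤n) s ∘ cong proj₂) , inj₁ (inj₂ (refl , inj₁ s))
  ahead⇒square-adjacent 3≤n {i , j} (next-column {i' = i'} (inj₂ a) s) =
    (step-moves (≤-trans (n≤1+n 2) 3≤n) s ∘ cong proj₂) , inj₂ ((i' , j) , inj₁ (a , refl) , inj₂ (refl , inj₁ s))
  ahead⇒square-adjacent 3≤n {i , j} (two-ahead {j' = j'} s s') =
    (two-steps-move 3≤n s s' ∘ cong proj₂) , inj₂ ((i , j') , inj₂ (refl , inj₁ s) , inj₂ (refl , inj₁ s'))

at-most-two : ∀ {x y z} → x ≤ 1 → y ≤ 1 → z ≤ 1 → (0 < x → 0 < y → 0 < z → ⊥) → x + y + z ≤ 2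
at-most-two z≤n       y≤1       z≤1       _    = +-mono-≤ y≤1 z≤1
at-most-two (s≤s z≤n) z≤n       z≤1       _    = s≤s z≤1
at-most-two (s≤s z≤n) (s≤s z≤n) z≤n       _    = ≤-refl
at-most-two (s≤s z≤n) (s≤s z≤n) (s≤s z≤n) ¬all = ⊥-elim (¬all ≤-refl ≤-refl ≤-refl)

three-times : ∀ x → 3 * x ≡ x + x + x
three-times x = trans (cong (λ y → x + (x + y)) (+-identityʳ x)) (sym (+-assoc x x x))

-- The sizes of the k colour classes of a colouring of T₄,ₙ²:
-- together they cover the 4n vertices, and each is at most 2n/3.
record ClassSizes (n k : ℕ) : Set where
  field
    size  : Fin k → ℕ
    total : ∑[ a < k ] size a ≡ 4 * n
    bound : ∀ a → 3 * size a ≤ 2 * n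

module ColourClasses {n : ℕ} .{{_ : NonZero n}} (3≤n : 3 ≤ n) {k : ℕ}
  (c : V (T4 n) → Fin k) (proper : ∀ u v → Adj (square (T4 n)) u v → c u ≢ c v) where

  distinct-ahead : ∀ {u v} → Ahead u v → c u ≢ c v
  distinct-ahead {u} {v} u→v = proper u v (ahead⇒square-adjacent 3≤n u→v)

  -- How often colour a occurs in column j: at most once, as a column is a clique.
  occ : Fin k → Fin n → ℕ
  occ a j = count (λ r → c (r , j)) a

  occ≤1 : ∀ a j → occ a j ≤ 1
  occ≤1 a j = count-injective (λ r → c (r , j)) (λ r s r≢s → distinct-ahead (same-column r≢s)) a

  -- No colour occurs in three consecutive columns: its rows in neighbouring columns
  -- would be opposite, so it would recur in one row two columns apart.
  not-thrice : ∀ a j → 0 < occ a j → 0 < occ a (next j) → 0 < occ a (next (next j)) → ⊥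
  not-thrice a j p p' p'' with count-present _ a p | count-present _ a p' | count-present _ a p''
  ... | r , cr≡a | s , cs≡a | t , ct≡a = distinct-ahead (two-ahead step₁ step₂) (trans cr≡a (sym cr″≡a))
    where
    step₁ : Step j (next j)
    step₁ = step-next j
    step₂ : Step (next j) (next (next j))
    step₂ = step-next (next j)
    far₁ : ¬ Close r s
    far₁ r~s = distinct-ahead (next-column r~s step₁) (trans cr≡a (sym cs≡a))
    far₂ : ¬ Close s t
    far₂ s~t = distinct-ahead (next-column s~t step₂) (trans cs≡a (sym ct≡a))
    cr″≡a : c (r , next (next j)) ≡ a
    cr″≡a = subst (λ q → c (q , next (next j)) ≡ a) (sym (far-twice r s t far₁ far₂)) ct≡a

  window≤2 : ∀ a j → occ a j + occ a (next j) + occ a (next (next j)) ≤ 2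
  window≤2 a j = at-most-two (occ≤1 a j) (occ≤1 a (next j)) (occ≤1 a (next (next j))) (not-thrice a j)

  class-size : Fin k → ℕ
  class-size a = ∑[ j < n ] occ a j

  -- Summing window≤2 over the n windows counts every column three times.
  class-bound : ∀ a → 3 * class-size a ≤ 2 * n
  class-bound a = begin
    3 * sum f                                             ≡⟨ three-times (sum f) ⟩
    sum f + sum f + sum f                                 ≡⟨ cong₂ (λ x y → sum f + x + y) (∑-next f) (trans (∑-next (f ∘ next)) (∑-next f)) ⟨
    sum f + sum (f ∘ next) + sum (f ∘ next ∘ next)        ≡⟨ cong (_+ sum (f ∘ next ∘ next)) (∑-distrib-+ f (f ∘ next)) ⟨
    sum (λ j → f j + f (next j)) + sum (f ∘ next ∘ next)  ≡⟨ ∑-distrib-+ (λ j → f j + f (next j)) (f ∘ next ∘ next) ⟨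
    ∑[ j < n ] (f j + f (next j) + f (next (next j)))     ≤⟨ ∑-bounded 2 (window≤2 a) ⟩
    n * 2                                                 ≡⟨ *-comm n 2 ⟩
    2 * n                                                 ∎
    where
    open ≤-Reasoning
    f : Fin n → ℕ
    f = occ a

  -- Every vertex has exactly one colour.
  classes-total : ∑[ a < k ] class-size a ≡ 4 * n
  classes-total = begin
    ∑[ a < k ] ∑[ j < n ] ∑[ r < 4 ] δ (c (r , j)) a  ≡⟨ ∑-comm (λ a j → ∑[ r < 4 ] δ (c (r , j)) a) ⟩
    ∑[ j < n ] ∑[ a < k ] ∑[ r < 4 ] δ (c (r , j)) a  ≡⟨ sum-cong-≗ {n} (λ j → ∑-comm (λ a r → δ (c (r , j)) a)) ⟩
    ∑[ j < n ] ∑[ r < 4 ] ∑[ a < k ] δ (c (r , j)) a  ≡⟨ sum-cong-≗ {n} (λ j → sum-cong-≗ {4} (λ r → ∑-δ (c (r , j)))) ⟩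
    ∑[ j < n ] 4                                      ≡⟨ ∑-const n 4 ⟩
    n * 4                                             ≡⟨ *-comm n 4 ⟩
    4 * n                                             ∎
    where open ≡-Reasoning

class-sizes : ∀ {n k} .{{_ : NonZero n}} → 3 ≤ n → ProperColouring (square (T4 n)) k → ClassSizes n k
class-sizes 3≤n (c , proper) = record { size = class-size ; total = classes-total ; bound = class-bound }
  where open ColourClasses 3≤n c proper

some-colour : ∀ {n k} → ClassSizes n k → 0 < n → 0 < k
some-colour {k = suc _} _ _   = s≤s z≤n
some-colour {k = zero}  C 0<n = ⊥-elim (<⇒≢ (*-monoʳ-< 4 0<n) (ClassSizes.total C))

module _ {n k : ℕ} (C : ClassSizes n k) where
  open ClassSizes C

  triple-total : ∑[ a < k ] (3 * size a) ≡ 3 * (4 * n)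
  triple-total = trans (sym (*-distribˡ-sum 3 size)) (cong (3 *_) total)

  at-least-six : 0 < n → 6 ≤ k
  at-least-six 0<n = *-cancelʳ-≤ 6 k (2 * n) {{>-nonZero (*-monoʳ-< 2 0<n)}} (begin
    6 * (2 * n)              ≡⟨ trans (sym (*-assoc 6 2 n)) (*-assoc 3 4 n) ⟩
    3 * (4 * n)              ≡⟨ triple-total ⟨
    ∑[ a < k ] (3 * size a)  ≤⟨ ∑-bounded (2 * n) bound ⟩
    k * (2 * n)              ∎)
    where open ≤-Reasoning

  -- If 3 ∤ n then 3 ∤ 2n, so every class is strictly below 2n/3 and k + 12n ≤ k · 2n.
  at-least-seven : n % 3 ≢ 0 → 7 ≤ k
  at-least-seven n%3≢0 with 7 ≤? k
  ... | yes 7≤k = 7≤k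
  ... | no  7≰k = ⊥-elim (<⇒≱ (+-monoˡ-< (3 * (4 * n)) 0<k) (begin
    k + 3 * (4 * n)                             ≡⟨ cong₂ _+_ (trans (∑-const k 1) (*-identityʳ k)) triple-total ⟨
    (∑[ a < k ] 1) + (∑[ a < k ] (3 * size a))  ≡⟨ ∑-distrib-+ (λ _ → 1) (λ a → 3 * size a) ⟨
    ∑[ a < k ] (1 + 3 * size a)                 ≤⟨ ∑-bounded (2 * n) below-two-thirds ⟩
    k * (2 * n)                                 ≤⟨ *-monoˡ-≤ (2 * n) (≤-pred (≰⇒> 7≰k)) ⟩
    6 * (2 * n)                                 ≡⟨ trans (sym (*-assoc 6 2 n)) (*-assoc 3 4 n) ⟩
    3 * (4 * n)                                 ∎))
    where
    open ≤-Reasoning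
    3∤2n : ∀ x → 3 * x ≢ 2 * n
    3∤2n x 3x≡2n = n%3≢0 (n∣m⇒m%n≡0 n 3 (coprime-divisor (from-yes (coprime? 3 2))
      (divides x (trans (sym 3x≡2n) (*-comm 3 x)))))
    below-two-thirds : ∀ a → 1 + 3 * size a ≤ 2 * n
    below-two-thirds a = ≤∧≢⇒< (bound a) (3∤2n (size a))
    0<k : 0 < k
    0<k = some-colour C (n≢0⇒n>0 λ n≡0 → n%3≢0 (subst (λ m → m % 3 ≡ 0) (sym n≡0) refl))

-- For n = 4 a class has at most ⌊8/3⌋ = 2 vertices, so 16 ≤ 2k.
at-least-eight : ∀ {k} → ClassSizes 4 k → 8 ≤ k
at-least-eight {k} C = *-cancelʳ-≤ 8 k 6 (begin
  3 * (4 * 4)              ≡⟨ triple-total C ⟨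
  ∑[ a < k ] (3 * size a)  ≤⟨ ∑-bounded 6 at-most-six ⟩
  k * 6                    ∎)
  where
  open ≤-Reasoning
  open ClassSizes C
  at-most-six : ∀ a → 3 * size a ≤ 6
  at-most-six a = *-monoʳ-≤ 3 (≤-pred (*-cancelˡ-< 3 (size a) 3 (s≤s (bound a))))

Column : ℕ → Set
Column k = Fin 4 → Fin k

rows : ∀ {k} → Fin k → Fin k → Fin k → Fin k → Column k
rows a b c d 0F = a
rows a b c d 1F = b
rows a b c d 2F = c
rows a b c d 3F = d

-- Colourings x, y, z of three consecutive columns fit together in the square when
-- x is injective, x and y differ on close rows, and x and z differ on each row.
Compatible : ∀ {k} → Column k → Column k → Column k → Set
Compatible x y z = (∀ r s → r ≢ s → x r ≢ x s) × (∀ r s → Close r s → x r ≢ y s) × (∀ r → x r ≢ z r)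

compatible? : ∀ {k} (x y z : Column k) → Dec (Compatible x y z)
compatible? x y z =
  (all? λ r → all? λ s → ¬? (r ≟ s) →-dec ¬? (x r ≟ x s)) ×-dec
  (all? λ r → all? λ s → close? r s →-dec ¬? (x r ≟ y s)) ×-dec
  (all? λ r → ¬? (x r ≟ z r))

compatible-cong : ∀ {k} {x x' y y' z z' : Column k} → x ≡ x' → y ≡ y' → z ≡ z' →
  Compatible x y z → Compatible x' y' z'
compatible-cong refl refl refl xyz = xyz

columns-colouring : ∀ {n} .{{_ : NonZero n}} {k} (S : Fin n → Column k) →
  (∀ j → Compatible (S j) (S (next j)) (S (next (next j)))) → ProperColouring (square (T4 n)) k
columns-colouring {n} {k} S compatible = colour , proper
  where
  colour : V (T4 n) → Fin k
  colour (i , j) = S j i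
  ahead-distinct : ∀ {u v} → Ahead u v → colour u ≢ colour v
  ahead-distinct (same-column {j = j} i≢i') = proj₁ (compatible j) _ _ i≢i'
  ahead-distinct (next-column {j = j} i~i' s) rewrite step⇒next s = proj₁ (proj₂ (compatible j)) _ _ i~i'
  ahead-distinct (two-ahead {j = j} s s') rewrite step⇒next s' | step⇒next s = proj₂ (proj₂ (compatible j)) _
  proper : ∀ u v → Adj (square (T4 n)) u v → colour u ≢ colour v
  proper u v u~v with square-adjacent⇒ahead u v u~v
  ... | inj₁ u→v = ahead-distinct u→v
  ... | inj₂ v→u = ahead-distinct v→u ∘ sym

-- entry d w m is the m-th entry of w, or d when w is too short.
entry : ∀ {A : Set} → A → List A → ℕ → A
entry d []      _       = d
entry d (x ∷ w) zero    = x
entry d (x ∷ w) (suc m) = entry d w m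

module _ {A : Set} (d : A) where

  entry-++ˡ : ∀ w v {m} → m < length w → entry d (w ++ v) m ≡ entry d w m
  entry-++ˡ (x ∷ w) v {zero}  _         = refl
  entry-++ˡ (x ∷ w) v {suc m} (s≤s m<w) = entry-++ˡ w v m<w

  entry-++ʳ : ∀ w v m → entry d (w ++ v) (length w + m) ≡ entry d v m
  entry-++ʳ []      v m = refl
  entry-++ʳ (x ∷ w) v m = entry-++ʳ w v m

  entry-take : ∀ t w {m} → m < t → entry d (take t w) m ≡ entry d w m
  entry-take (suc t) []      _                   = refl
  entry-take (suc t) (x ∷ w) {zero}  _         = refl
  entry-take (suc t) (x ∷ w) {suc m} (s≤s m<t) = entry-take t w m<t

  entry-cyclic : ∀ {n} .{{_ : NonZero n}} w → length w ≡ n → 2 ≤ n → ∀ {p} → p < n + 2 →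
    entry d (w ++ take 2 w) p ≡ entry d w (p % n)
  entry-cyclic {n} w refl 2≤n {p} p<n+2 with p <? n
  ... | yes p<n = trans (entry-++ˡ w (take 2 w) p<n) (cong (entry d w) (sym (m<n⇒m%n≡m p<n)))
  ... | no  p≮n with q , refl ← m≤n⇒∃[o]m+o≡n (≮⇒≥ p≮n) = begin
    entry d (w ++ take 2 w) (n + q)  ≡⟨ entry-++ʳ w (take 2 w) q ⟩
    entry d (take 2 w) q             ≡⟨ entry-take 2 w q<2 ⟩
    entry d w q                      ≡⟨ cong (entry d w) [n+q]%n≡q ⟨
    entry d w ((n + q) % n)          ∎
    where
    open ≡-Reasoning
    q<2 : q < 2
    q<2 = +-cancelˡ-< n q 2 p<n+2
    [n+q]%n≡q : (n + q) % n ≡ q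
    [n+q]%n≡q = trans (cong (_% n) (+-comm n q)) (trans ([m+n]%n≡m%n q n) (m<n⇒m%n≡m (≤-trans q<2 2≤n)))

Windows : ∀ {k} → List (Column k) → Set
Windows (x ∷ y ∷ z ∷ w) = Compatible x y z × Windows (y ∷ z ∷ w)
Windows _               = ⊤

windows? : ∀ {k} (w : List (Column k)) → Dec (Windows w)
windows? (x ∷ y ∷ z ∷ w) = compatible? x y z ×-dec windows? (y ∷ z ∷ w)
windows? []              = yes tt
windows? (_ ∷ [])        = yes tt
windows? (_ ∷ _ ∷ [])    = yes tt

windows-entry : ∀ {k} d (w : List (Column k)) → Windows w → ∀ m → 2 + m < length w →
  Compatible (entry d w m) (entry d w (1 + m)) (entry d w (2 + m))
windows-entry d (x ∷ y ∷ z ∷ w) (xyz , _)  zero    _         = xyz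
windows-entry d (x ∷ y ∷ z ∷ w) (_ , rest) (suc m) (s≤s m<w) = windows-entry d (y ∷ z ∷ w) rest m m<w
windows-entry d (_ ∷ [])     _ _ (s≤s ())
windows-entry d (_ ∷ _ ∷ []) _ _ (s≤s (s≤s ()))

word-colouring : ∀ {n} .{{_ : NonZero n}} {k} (w : List (Column k)) → length w ≡ n → 3 ≤ n →
  Windows (w ++ take 2 w) → ProperColouring (square (T4 n)) k
word-colouring []        len 3≤n _ with () ← subst (3 ≤_) (sym len) 3≤n
word-colouring {n} {k} w@(x ∷ _) len 3≤n ok = columns-colouring S window
  where
  S : Fin n → Column k
  S j = entry x w (toℕ j)
  2≤n : 2 ≤ n
  2≤n = ≤-trans (n≤1+n 2) 3≤n
  L : List (Column k)
  L = w ++ take 2 w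
  length-L : length L ≡ n + 2
  length-L = begin
    length L                      ≡⟨ length-++ w ⟩
    length w + length (take 2 w)  ≡⟨ cong (length w +_) (length-take 2 w) ⟩
    length w + 2 ⊓ length w       ≡⟨ cong (λ l → l + 2 ⊓ l) len ⟩
    n + 2 ⊓ n                     ≡⟨ cong (n +_) (m≤n⇒m⊓n≡m 2≤n) ⟩
    n + 2                         ∎
    where open ≡-Reasoning
  reads : ∀ {p} j → toℕ j ≡ p % n → p < n + 2 → entry x L p ≡ S j
  reads j j≡p p<n+2 = trans (entry-cyclic x w len 2≤n p<n+2) (cong (entry x w) (sym j≡p))
  window : ∀ j → Compatible (S j) (S (next j)) (S (next (next j)))
  window j = compatible-cong
    (reads j (sym (m<n⇒m%n≡m m<n)) (≤-trans m<n (m≤m+n n 2)))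
    (reads (next j) (trans (toℕ-cyc (m + 1)) (cong (_% n) (+-comm m 1))) (shifted 1 (s≤s z≤n)))
    (reads (next (next j)) (sym (trans (cong (_% n) (+-comm 2 m)) (step-step (step-next j) (step-next (next j)))))
      (shifted 2 ≤-refl))
    (windows-entry x L ok m (subst (2 + m <_) (sym length-L) (shifted 2 ≤-refl)))
    where
    m : ℕ
    m = toℕ j
    m<n : m < n
    m<n = toℕ<n j
    shifted : ∀ d → d ≤ 2 → d + m < n + 2
    shifted d d≤2 = subst (d + m <_) (+-comm 2 n) (+-mono-≤-< d≤2 m<n)

repeat : ∀ {A : Set} → A → A → A → ℕ → List A
repeat x y z zero    = []
repeat x y z (suc q) = x ∷ y ∷ z ∷ repeat x y z q

length-repeat-++ : ∀ {A : Set} (x y z : A) q t → length (repeat x y z q ++ t) ≡ q * 3 + length t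
length-repeat-++ x y z zero    t = refl
length-repeat-++ x y z (suc q) t = cong (3 +_) (length-repeat-++ x y z q t)

windows-repeat : ∀ {k} {x y z : Column k} t → Compatible x y z → Compatible y z x → Compatible z x y →
  Windows (x ∷ y ∷ z ∷ t ++ x ∷ y ∷ []) → ∀ q → Windows ((repeat x y z (suc q) ++ t) ++ x ∷ y ∷ [])
windows-repeat t xyz yzx zxy base zero    = base
windows-repeat t xyz yzx zxy base (suc q) = xyz , yzx , zxy , windows-repeat t xyz yzx zxy base q

repeat-colouring : ∀ {k} (x y z : Column k) t → Compatible x y z → Compatible y z x → Compatible z x y →
  Windows (x ∷ y ∷ z ∷ t ++ x ∷ y ∷ []) →
  ∀ {n} .{{_ : NonZero n}} q → n ≡ suc q * 3 + length t → ProperColouring (square (T4 n)) k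
repeat-colouring x y z t xyz yzx zxy base q n≡ =
  word-colouring (repeat x y z (suc q) ++ t) (trans (length-repeat-++ x y z (suc q) t) (sym n≡))
    (subst (3 ≤_) (sym n≡) (≤-trans (m≤m+n 3 (q * 3)) (m≤m+n _ (length t))))
    (windows-repeat t xyz yzx zxy base q)

a₆ b₆ c₆ : Column 6
a₆ = rows 0F 1F 2F 3F
b₆ = rows 2F 3F 4F 5F
c₆ = rows 4F 5F 0F 1F

a₇ b₇ c₇ : Column 7
a₇ = rows 0F 1F 2F 3F
b₇ = rows 2F 3F 0F 4F
c₇ = rows 5F 4F 6F 1F

tail₄ tail₅ word₅ : List (Column 7)
tail₄ = rows 6F 0F 5F 2F ∷ rows 1F 2F 4F 3F ∷ rows 5F 3F 0F 6F ∷ rows 4F 6F 5F 1F ∷ []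
tail₅ = rows 0F 1F 2F 3F ∷ rows 2F 3F 4F 5F ∷ rows 1F 5F 6F 0F ∷ rows 4F 0F 3F 2F ∷ rows 5F 6F 4F 1F ∷ []
word₅ = rows 0F 1F 2F 3F ∷ rows 2F 3F 4F 5F ∷ rows 1F 5F 6F 0F ∷ rows 3F 2F 1F 4F ∷ rows 5F 4F 0F 6F ∷ []

word₄ : List (Column 8)
word₄ = rows 0F 1F 2F 3F ∷ rows 4F 5F 6F 7F ∷ rows 2F 3F 0F 1F ∷ rows 6F 7F 4F 5F ∷ []

block₆-colouring : ∀ {n} .{{_ : NonZero n}} q → n ≡ suc q * 3 + 0 → ProperColouring (square (T4 n)) 6
block₆-colouring = repeat-colouring a₆ b₆ c₆ []
  (from-yes (compatible? a₆ b₆ c₆)) (from-yes (compatible? b₆ c₆ a₆)) (from-yes (compatible? c₆ a₆ b₆))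
  (from-yes (windows? (a₆ ∷ b₆ ∷ c₆ ∷ a₆ ∷ b₆ ∷ [])))

block₇-colouring : ∀ t → Windows (a₇ ∷ b₇ ∷ c₇ ∷ t ++ a₇ ∷ b₇ ∷ []) →
  ∀ {n} .{{_ : NonZero n}} q → n ≡ suc q * 3 + length t → ProperColouring (square (T4 n)) 7
block₇-colouring t = repeat-colouring a₇ b₇ c₇ t
  (from-yes (compatible? a₇ b₇ c₇)) (from-yes (compatible? b₇ c₇ a₇)) (from-yes (compatible? c₇ a₇ b₇))

mod3-form : ∀ n → 3 ≤ n → ∃ λ q → n ≡ suc q * 3 + n % 3
mod3-form n 3≤n with n / 3 | m≡m%n+[m/n]*n n 3 | m≥n⇒m/n>0 {n} {3} 3≤n
... | suc q | n≡ | _ = q , trans n≡ (+-comm (n % 3) _)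

shift-block : ∀ q r → suc (suc q) * 3 + r ≡ suc q * 3 + (3 + r)
shift-block q r = xy∙z≈y∙xz 3 (suc q * 3) r

six-colourable : ∀ {n} .{{_ : NonZero n}} → 3 ≤ n → n % 3 ≡ 0 → ProperColouring (square (T4 n)) 6
six-colourable {n} 3≤n n%3≡0 with q , n≡ ← mod3-form n 3≤n =
  block₆-colouring q (trans n≡ (cong (suc q * 3 +_) n%3≡0))

seven-colourable₁ : ∀ {n} .{{_ : NonZero n}} q → n ≡ suc q * 3 + 1 → n ≢ 4 → ProperColouring (square (T4 n)) 7
seven-colourable₁ zero    n≡4 n≢4 = ⊥-elim (n≢4 n≡4)
seven-colourable₁ (suc q) n≡  _   = block₇-colouring tail₄
  (from-yes (windows? (a₇ ∷ b₇ ∷ c₇ ∷ tail₄ ++ a₇ ∷ b₇ ∷ []))) q (trans n≡ (shift-block q 1))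

seven-colourable₂ : ∀ {n} .{{_ : NonZero n}} q → n ≡ suc q * 3 + 2 → ProperColouring (square (T4 n)) 7
seven-colourable₂ zero    n≡5 = word-colouring word₅ (sym n≡5) (subst (3 ≤_) (sym n≡5) (m≤m+n 3 2))
  (from-yes (windows? (word₅ ++ take 2 word₅)))
seven-colourable₂ (suc q) n≡  = block₇-colouring tail₅
  (from-yes (windows? (a₇ ∷ b₇ ∷ c₇ ∷ tail₅ ++ a₇ ∷ b₇ ∷ []))) q (trans n≡ (shift-block q 2))

seven-colourable : ∀ {n} .{{_ : NonZero n}} → 3 ≤ n → n % 3 ≢ 0 → n ≢ 4 → ProperColouring (square (T4 n)) 7
seven-colourable {n} 3≤n n%3≢0 n≢4 with q , n≡ ← mod3-form n 3≤n with n % 3 | m%n<n n 3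
... | 0                 | _                  = ⊥-elim (n%3≢0 refl)
... | 1                 | _                  = seven-colourable₁ q n≡ n≢4
... | 2                 | _                  = seven-colourable₂ q n≡
... | suc (suc (suc _)) | s≤s (s≤s (s≤s ()))

eight-colourable : ProperColouring (square (T4 4)) 8
eight-colourable = word-colouring word₄ refl (m≤m+n 3 1) (from-yes (windows? (word₄ ++ take 2 word₄)))

chromatic : ∀ {G m} → ProperColouring G m → (∀ {k} → ProperColouring G k → m ≤ k) → ChromaticNumber G m
chromatic colouring lower = colouring , λ k k<m χ → <⇒≱ k<m (lower χ)

chromatic-four : ∀ n .{{_ : NonZero n}} → n ≡ 4 → ChromaticNumber (square (T4 n)) 8
chromatic-four .4 refl = chromatic eight-colourable (at-least-eight ∘ class-sizes (m≤m+n 3 1))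

theorem6 : (n : ℕ) → .{{_ : NonZero n}} → 3 ≤ n →
    (n % 3 ≡ 0 → ChromaticNumber (square (T4 n)) 6) ×
    (n ≡ 4 → ChromaticNumber (square (T4 n)) 8) ×
    (n % 3 ≢ 0 → n ≢ 4 → ChromaticNumber (square (T4 n)) 7)
theorem6 n 3≤n =
  (λ n%3≡0 → chromatic (six-colourable 3≤n n%3≡0) (λ χ → at-least-six (class-sizes 3≤n χ) 0<n)) ,
  chromatic-four n ,
  (λ n%3≢0 n≢4 → chromatic (seven-colourable 3≤n n%3≢0 n≢4) (λ χ → at-least-seven (class-sizes 3≤n χ) n%3≢0))
  where
  0<n : 0 < n
  0<n = ≤-trans (s≤s z≤n) 3≤n
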